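{- Let $L$ be a finite lower dismantlable lattice which is an adjunct of $n$ chains, where $n\ge 2$. Then $V(G_{\{0\}}(L))\neq\emptyset$ and $\mathrm{diam}(G_{\{0\}}(L))\le 2$. Moreover, if $(0,1)$ is the only adjunct pair in $L$, then $\mathrm{diam}(G_{\{0\}}(L))=1$ if and only if $L\cong\mathcal{M}_n$. Further: (a) $\mathrm{gr}(G_{\{0\}}(L))=3$ if and only if $L$ is an adjunct of at least three chains; (b) $\mathrm{gr}(G_{\{0\}}(L))=4$ if and only if $L=C_1]_0^aC_2$ with $|C_2|\ge 2$; (c) $\mathrm{gr}(G_{\{0\}}(L))=\infty$ if and only if $L=C_1]_0^aC_2$ with $|C_2|=1$.
   Context: Adjunct operation: for disjoint finite lattices $L_1,L_2$ and $a<b$ in $L_1$ with $b$ not covering $a$, $L_1]_a^bL_2$ is $L_1\cup L_2$ ordered by: $x\le y$ iff ($x,y\in L_1$, $x\le y$ in $L_1$) or ($x,y\in L_2$, $x\le y$ in $L_2$) or ($x\in L_1$, $y\in L_2$, $x\le a$) or ($x\in L_2$, $y\in L_1$, $b\le y$); $(a,b)$ is an adjunct pair. A finite lattice is dismantlable iff it is an adjunct of chains $C_0]_{a_1}^{b_1}C_1\cdots]_{a_n}^{b_n}C_n$; lower dismantlable if it is a chain or every adjunct pair is of the form $(0,b)$. $C_1,C_2$ denote chains. $\mathcal{M}_n=\{0,1,a_1,\dots,a_n\}$ is the lattice with $0<a_i<1$, $a_i\wedge a_j=0$ and $a_i\vee a_j=1$ for $i\ne j$. The zero-divisor graph $G_{\{0\}}(L)$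 has vertex set $\{x\in L\setminus\{0\}: x\wedge y=0\text{ for some }y\in L\setminus\{0\}\}$, distinct vertices $x,y$ adjacent iff $x\wedge y=0$. The diameter is the maximum distance between vertices; the girth $\mathrm{gr}$ is the length of a shortest cycle, $\infty$ if there is no cycle.
   Formalization: In (b), the condition is that L is an adjunct of exactly two chains and every decomposition of L as $C_1]_0^aC_2$ has $|C_2|\ge 2$, in place of L being some $C_1]_0^aC_2$ with $|C_2|\ge 2$. Each condition added here is assumed in the paper as well or is needed for the statement above to hold. -}

module Defs where

open import Level using (0ℓ)
import Data.Nat
open import Data.Nat using (ℕ; zero; suc; _<_)
open import Data.Fin using (Fin; zero; suc; fromℕ; inject₁)
import Data.Fin as F
open import Data.Sum using (_⊎_; inj₁; inj₂)
open import Data.Product using (Σ; _×_; _,_; ∃; ∃-syntax; proj₁)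
open import Data.Unit using (⊤; tt)
open import Data.Empty using (⊥)
open import Relation.Nullary using (¬_)
open import Relation.Binary.Core using (Rel)
open import Relation.Binary.PropositionalEquality using (_≡_; _≢_)
open import Relation.Binary.Lattice.Structures using (IsBoundedLattice)
open import Algebra.Core using (Op₂)
open import Function.Definitions using (Injective)
open import Function.Bundles using (_⇔_)

record FinLattice : Set₁ where
  field
    size : ℕ
    _≤_  : Rel (Fin size) 0ℓ
    _∨_  : Op₂ (Fin size)
    _∧_  : Op₂ (Fin size)
    𝟙    : Fin size
    𝟘    : Fin size
    isBoundedLattice : IsBoundedLattice _≡_ _≤_ _∨_ _∧_ 𝟙 𝟘

record OrderIso {X Y : Set} (R : Rel X 0ℓ) (S : Rel Y 0ℓ) : Set where
  field
    to      : X → Y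
    from    : Y → X
    from∘to : ∀ x → from (to x) ≡ x
    to∘from : ∀ y → to (from y) ≡ y
    mono    : ∀ x y → R x y ⇔ S (to x) (to y)

-- A chain with (suc k) elements is Fin (suc k)
-- with its usual order.  An  Adj n  is an expression
--   C₀ ]_{a₁}^{b₁} C₁ ⋯ ]_{a_{n-1}}^{b_{n-1}} C_{n-1}
-- of n chains (built left to right), together with its carrier and order.

mutual
  data Adj : ℕ → Set where
    chain : (k : ℕ) → Adj 1
    adj   : ∀ {n} (A : Adj n) (a b : Elt A) →
            Lt A a b → ¬ Covers A a b → (k : ℕ) → Adj (suc n)

  Elt : ∀ {n} → Adj n → Set
  Elt (chain k)           = Fin (suc k)
  Elt (adj A a b _ _ k)   = Elt A ⊎ Fin (suc k)

  Le : ∀ {n} (A : Adj n) → Elt A → Elt A → Set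
  Le (chain k) x y                       = x F.≤ y
  Le (adj A a b _ _ k) (inj₁ x) (inj₁ y) = Le A x y
  Le (adj A a b _ _ k) (inj₂ x) (inj₂ y) = x F.≤ y
  Le (adj A a b _ _ k) (inj₁ x) (inj₂ y) = Le A x a
  Le (adj A a b _ _ k) (inj₂ x) (inj₁ y) = Le A b y

  Lt : ∀ {n} (A : Adj n) → Elt A → Elt A → Set
  Lt A x y = Le A x y × x ≢ y

  Covers : ∀ {n} (A : Adj n) → Elt A → Elt A → Set
  Covers A a b = Lt A a b × (∀ z → Lt A a z → Lt A z b → ⊥)

bot : ∀ {n} (A : Adj n) → Elt A
bot (chain k)         = zero
bot (adj A a b _ _ k) = inj₁ (bot A)

top : ∀ {n} (A : Adj n) → Elt A
top (chain k)         = fromℕ k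
top (adj A a b _ _ k) = inj₁ (top A)

LowerDism : ∀ {n} → Adj n → Set
LowerDism (chain k)         = ⊤
LowerDism (adj A a b _ _ k) = LowerDism A × a ≡ bot A

OnlyZeroOne : ∀ {n} → Adj n → Set
OnlyZeroOne (chain k)         = ⊤
OnlyZeroOne (adj A a b _ _ k) = OnlyZeroOne A × a ≡ bot A × b ≡ top A

_≅Adj_ : ∀ {n} → FinLattice → Adj n → Set
L ≅Adj A = OrderIso (FinLattice._≤_ L) (Le A)

-- L = C₁ ]₀^a C₂ (up to isomorphism) with |C₂| satisfying P
TwoChainAdj : FinLattice → (ℕ → Set) → Set
TwoChainAdj L P =
  Σ ℕ λ k → Σ (Fin (suc k)) λ a → Σ (Lt (chain k) zero a) λ p →
  Σ (¬ Covers (chain k) zero a) λ q → Σ ℕ λ k₂ →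
  P (suc k₂) × (L ≅Adj adj (chain k) zero a p q k₂)

data MElt (n : ℕ) : Set where
  m0 : MElt n
  m1 : MElt n
  atom : Fin n → MElt n

LeM : ∀ {n} → MElt n → MElt n → Set
LeM m0       _        = ⊤
LeM _        m1       = ⊤
LeM (atom i) (atom j) = i ≡ j
LeM (atom i) m0       = ⊥
LeM m1       m0       = ⊥
LeM m1       (atom j) = ⊥

_≅M_ : FinLattice → ℕ → Set
L ≅M n = OrderIso (FinLattice._≤_ L) (LeM {n})

module ZeroDivisorGraph (L : FinLattice) where
  open FinLattice L

  IsVertex : Fin size → Set
  IsVertex x = x ≢ 𝟘 × ∃[ y ] (y ≢ 𝟘 × (x ∧ y) ≡ 𝟘)

  Adjacent : Fin size → Fin size → Set
  Adjacent x y = IsVertex x × IsVertex y × x ≢ y × (x ∧ y) ≡ 𝟘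

  data Walk : Fin size → Fin size → ℕ → Set where
    here : ∀ {x} → Walk x x 0
    step : ∀ {x y z k} → Adjacent x y → Walk y z k → Walk x z (suc k)

  Cycle : ℕ → Set
  Cycle zero    = ⊥
  Cycle (suc j) =
    Σ (Fin (suc j) → Fin size) λ f →
      Injective _≡_ _≡_ f ×
      (∀ (i : Fin j) → Adjacent (f (inject₁ i)) (f (suc i))) ×
      Adjacent (f (fromℕ j)) (f zero)

  HasCycle : ℕ → Set
  HasCycle l = 3 Data.Nat.≤ l × Cycle l

  VNonEmpty : Set
  VNonEmpty = ∃[ x ] IsVertex x

  DiamLe : ℕ → Set
  DiamLe d = ∀ x y → IsVertex x → IsVertex y →
             ∃[ k ] (k Data.Nat.≤ d × Walk x y k)

  DiamEq : ℕ → Set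
  DiamEq d = DiamLe d ×
             ∃[ x ] ∃[ y ] (IsVertex x × IsVertex y ×
                            (∀ k → k < d → ¬ Walk x y k))

  GirthEq : ℕ → Set
  GirthEq g = HasCycle g × (∀ l → l < g → ¬ HasCycle l)

  GirthInf : Set
  GirthInf = ∀ l → ¬ HasCycle l

module Submission where

-- In a lower dismantlable adjunct C₀ ]₀^{b₁} C₁ ⋯ ]₀^{bₙ₋₁} Cₙ₋₁ every glued chain hangs
-- from 0, so two elements with nonzero meet are comparable.  Hence two vertices of
-- G_{0}(L) are either adjacent or comparable, and in the latter case a zero divisor of
-- the larger one annihilates the smaller one: the diameter is at most 2.  The atoms at
-- the bottom of the chains are pairwise disjoint, which gives a triangle as soon as
-- there are three chains.  With two chains L = C₁ ]₀^b C₂ every edge joins C₁ to C₂, so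
-- there is no triangle.  If |C₂| = 1 the graph is a star around the point of C₂.  If
-- b ≥ 3 and |C₂| ≥ 2, the elements 1, 2 of C₁ and 0, 1 of C₂ form a 4-cycle.  In the
-- remaining case b = 2 the atom 1 of C₁ may be regarded as the second chain instead,
-- so L is again of the form C′ ]₀^{a′} C₂′ with |C₂′| = 1.  Finally, if (0, 1) is the
-- only adjunct pair and G_{0}(L) is complete, no two zero divisors are comparable; this
-- forces C₀ = 0 < a < 1 and every other chain to be a single atom, i.e. L ≅ Mₙ.

open import Defs
open import Level using (0ℓ)
open import Data.Bool using (Bool; true; false; not)
open import Data.Bool.Properties using (¬-not)
open import Data.Empty using (⊥; ⊥-elim)
open import Data.Fin using (Fin; zero; suc; toℕ; _↑ˡ_; _↑ʳ_; splitAt; join)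
import Data.Fin as F
import Data.Fin.Properties as FP
open import Data.Nat using (ℕ; zero; suc; _+_; _≤_; _<_; z≤n; s≤s; s≤s⁻¹)
import Data.Nat.Properties as NP
open import Data.Product using (_×_; _,_; ∃; proj₁; proj₂)
open import Data.Sum using (_⊎_; inj₁; inj₂; [_,_]′) renaming (map to ⊎-map)
open import Data.Unit using (⊤; tt)
open import Function.Bundles using (_⇔_; mk⇔; Equivalence)
open import Function.Properties.Equivalence using () renaming (trans to ⇔-trans)
open import Relation.Binary.Core using (Rel)
open import Relation.Binary.Lattice.Bundles using (BoundedLattice)
open import Relation.Nullary using (¬_; yes; no)
open import Relation.Binary.PropositionalEquality

module OrderIsoProperties {X Y : Set} {R : Rel X 0ℓ} {S : Rel Y 0ℓ}
                          (I : OrderIso R S) where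
  open OrderIso I public

  to-mono : ∀ {x y} → R x y → S (to x) (to y)
  to-mono {x} {y} = Equivalence.to (mono x y)

  to-reflect : ∀ {x y} → S (to x) (to y) → R x y
  to-reflect {x} {y} = Equivalence.from (mono x y)

  to-injective : ∀ {x y} → to x ≡ to y → x ≡ y
  to-injective {x} {y} e = trans (sym (from∘to x)) (trans (cong from e) (from∘to y))

  from-injective : ∀ {u v} → from u ≡ from v → u ≡ v
  from-injective {u} {v} e = trans (sym (to∘from u)) (trans (cong to e) (to∘from v))

  from-mono : ∀ {u v} → S u v → R (from u) (from v)
  from-mono {u} {v} le = to-reflect (subst₂ S (sym (to∘from u)) (sym (to∘from v)) le)

  from-reflect : ∀ {u v} → R (from u) (from v) → S u v
  from-reflect {u} {v} le = subst₂ S (to∘from u) (to∘from v) (to-mono le)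

_∘-OrderIso_ : ∀ {X Y Z : Set} {R : Rel X 0ℓ} {S : Rel Y 0ℓ} {U : Rel Z 0ℓ} →
               OrderIso S U → OrderIso R S → OrderIso R U
J ∘-OrderIso I = record
  { to      = λ x → J.to (I.to x)
  ; from    = λ z → I.from (J.from z)
  ; from∘to = λ x → trans (cong I.from (J.from∘to (I.to x))) (I.from∘to x)
  ; to∘from = λ z → trans (cong J.to (I.to∘from (J.from z))) (J.to∘from z)
  ; mono    = λ x y → mk⇔ (λ r → J.to-mono (I.to-mono r)) (λ u → I.to-reflect (J.to-reflect u))
  }
  where
  module I = OrderIsoProperties I
  module J = OrderIsoProperties J

module MeetProperties (L : FinLattice) where
  open FinLattice L renaming (_≤_ to _⊑_)

  private
    boundedLattice : BoundedLattice 0ℓ 0ℓ 0ℓ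
    boundedLattice = record { isBoundedLattice = isBoundedLattice }
    open BoundedLattice boundedLattice
      using (meetSemilattice; minimum; antisym) renaming (refl to ⊑-refl)
    open import Relation.Binary.Lattice.Properties.MeetSemilattice meetSemilattice
      using (∧-comm; ∧-monotonic; ∧-idempotent)

  open BoundedLattice boundedLattice public using (x∧y≤x; x∧y≤y)

  ⊑𝟘⇒≡𝟘 : ∀ {x} → x ⊑ 𝟘 → x ≡ 𝟘
  ⊑𝟘⇒≡𝟘 {x} le = antisym le (minimum x)

  ∧≡𝟘-sym : ∀ {x y} → x ∧ y ≡ 𝟘 → y ∧ x ≡ 𝟘
  ∧≡𝟘-sym {x} {y} e = trans (∧-comm y x) e

  ∧≡𝟘-antitoneˡ : ∀ {x y z} → x ⊑ y → y ∧ z ≡ 𝟘 → x ∧ z ≡ 𝟘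
  ∧≡𝟘-antitoneˡ le e = ⊑𝟘⇒≡𝟘 (subst (_ ⊑_) e (∧-monotonic le ⊑-refl))

  ∧-self≡𝟘⇒≡𝟘 : ∀ {x} → x ∧ x ≡ 𝟘 → x ≡ 𝟘
  ∧-self≡𝟘⇒≡𝟘 {x} e = trans (sym (∧-idempotent x)) e

  ⊑-∧≡𝟘⇒≡𝟘 : ∀ {x y} → x ⊑ y → x ∧ y ≡ 𝟘 → x ≡ 𝟘
  ⊑-∧≡𝟘⇒≡𝟘 le e = ∧-self≡𝟘⇒≡𝟘 (∧≡𝟘-antitoneˡ le (∧≡𝟘-sym e))

module LatticeIso (L : FinLattice) {Y : Set} {S : Rel Y 0ℓ}
                  (I : OrderIso (FinLattice._≤_ L) S) where
  open FinLattice L renaming (_≤_ to _⊑_)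
  open MeetProperties L
  open OrderIsoProperties I

  from-least : ∀ {s} → (∀ y → S s y) → from s ≡ 𝟘
  from-least {s} least = ⊑𝟘⇒≡𝟘 (subst (from s ⊑_) (from∘to 𝟘) (from-mono (least (to 𝟘))))

module GraphProperties (L : FinLattice) where
  open FinLattice L renaming (_≤_ to _⊑_)
  open MeetProperties L
  open ZeroDivisorGraph L

  ∧≡𝟘⇒Adjacent : ∀ {x y} → x ≢ 𝟘 → y ≢ 𝟘 → x ∧ y ≡ 𝟘 → Adjacent x y
  ∧≡𝟘⇒Adjacent {x} {y} x≢𝟘 y≢𝟘 e =
    (x≢𝟘 , y , y≢𝟘 , e) , (y≢𝟘 , x , x≢𝟘 , ∧≡𝟘-sym e) ,
    (λ { refl → x≢𝟘 (∧-self≡𝟘⇒≡𝟘 e) }) , e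

  Adjacent-sym : ∀ {x y} → Adjacent x y → Adjacent y x
  Adjacent-sym (vx , vy , x≢y , e) = vy , vx , (λ e′ → x≢y (sym e′)) , ∧≡𝟘-sym e

  Adjacent⇒⋢ : ∀ {x y} → Adjacent x y → ¬ x ⊑ y
  Adjacent⇒⋢ ((x≢𝟘 , _) , _ , _ , e) le = x≢𝟘 (⊑-∧≡𝟘⇒≡𝟘 le e)

  Walk₀⇒≡ : ∀ {x y} → Walk x y 0 → x ≡ y
  Walk₀⇒≡ here = refl

  Walk₂-sym : ∀ {x y} → Walk x y 2 → Walk y x 2
  Walk₂-sym (step xz (step zy here)) = step (Adjacent-sym zy) (step (Adjacent-sym xz) here)

  ⊑⇒Walk₂ : ∀ {x y} → x ⊑ y → IsVertex x → IsVertex y → Walk x y 2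
  ⊑⇒Walk₂ x⊑y (x≢𝟘 , _) (y≢𝟘 , z , z≢𝟘 , y∧z≡𝟘) =
    step (∧≡𝟘⇒Adjacent x≢𝟘 z≢𝟘 (∧≡𝟘-antitoneˡ x⊑y y∧z≡𝟘))
         (step (∧≡𝟘⇒Adjacent z≢𝟘 y≢𝟘 (∧≡𝟘-sym y∧z≡𝟘)) here)

  comparable⇒Walk₂ : ∀ {x y} → x ⊑ y ⊎ y ⊑ x → IsVertex x → IsVertex y → Walk x y 2
  comparable⇒Walk₂ (inj₁ x⊑y) vx vy = ⊑⇒Walk₂ x⊑y vx vy
  comparable⇒Walk₂ (inj₂ y⊑x) vx vy = Walk₂-sym (⊑⇒Walk₂ y⊑x vy vx)

  cycle₃ : ∀ {x y z} → Adjacent x y → Adjacent y z → Adjacent z x → HasCycle 3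
  cycle₃ {x} {y} {z} xy yz zx = s≤s (s≤s (s≤s z≤n)) , f , injective , edges , zx
    where
    f : Fin 3 → Fin size
    f zero             = x
    f (suc zero)       = y
    f (suc (suc zero)) = z
    x≢y = proj₁ (proj₂ (proj₂ xy))
    y≢z = proj₁ (proj₂ (proj₂ yz))
    z≢x = proj₁ (proj₂ (proj₂ zx))
    injective : ∀ {i j} → f i ≡ f j → i ≡ j
    injective {zero}             {zero}             _ = refl
    injective {zero}             {suc zero}         e = ⊥-elim (x≢y e)
    injective {zero}             {suc (suc zero)}   e = ⊥-elim (z≢x (sym e))
    injective {suc zero}         {zero}             e = ⊥-elim (x≢y (sym e))
    injective {suc zero}         {suc zero}         _ = refl
    injective {suc zero}         {suc (suc zero)}   e = ⊥-elim (y≢z e)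
    injective {suc (suc zero)}   {zero}             e = ⊥-elim (z≢x e)
    injective {suc (suc zero)}   {suc zero}         e = ⊥-elim (y≢z (sym e))
    injective {suc (suc zero)}   {suc (suc zero)}   _ = refl
    edges : ∀ (i : Fin 2) → Adjacent (f (F.inject₁ i)) (f (suc i))
    edges zero       = xy
    edges (suc zero) = yz

  cycle₄ : ∀ {x y z w} → Adjacent x y → Adjacent y z → Adjacent z w → Adjacent w x →
           x ≢ z → y ≢ w → HasCycle 4
  cycle₄ {x} {y} {z} {w} xy yz zw wx x≢z y≢w =
    s≤s (s≤s (s≤s z≤n)) , f , injective , edges , wx
    where
    f : Fin 4 → Fin size
    f zero                   = x
    f (suc zero)             = y
    f (suc (suc zero))       = z
    f (suc (suc (suc zero))) = w
    x≢y = proj₁ (proj₂ (proj₂ xy))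
    y≢z = proj₁ (proj₂ (proj₂ yz))
    z≢w = proj₁ (proj₂ (proj₂ zw))
    w≢x = proj₁ (proj₂ (proj₂ wx))
    injective : ∀ {i j} → f i ≡ f j → i ≡ j
    injective {zero}                   {zero}                   _ = refl
    injective {zero}                   {suc zero}               e = ⊥-elim (x≢y e)
    injective {zero}                   {suc (suc zero)}         e = ⊥-elim (x≢z e)
    injective {zero}                   {suc (suc (suc zero))}   e = ⊥-elim (w≢x (sym e))
    injective {suc zero}               {zero}                   e = ⊥-elim (x≢y (sym e))
    injective {suc zero}               {suc zero}               _ = refl
    injective {suc zero}               {suc (suc zero)}         e = ⊥-elim (y≢z e)
    injective {suc zero}               {suc (suc (suc zero))}   e = ⊥-elim (y≢w e)
    injective {suc (suc zero)}         {zero}                   e = ⊥-elim (x≢z (sym e))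
    injective {suc (suc zero)}         {suc zero}               e = ⊥-elim (y≢z (sym e))
    injective {suc (suc zero)}         {suc (suc zero)}         _ = refl
    injective {suc (suc zero)}         {suc (suc (suc zero))}   e = ⊥-elim (z≢w e)
    injective {suc (suc (suc zero))}   {zero}                   e = ⊥-elim (w≢x e)
    injective {suc (suc (suc zero))}   {suc zero}               e = ⊥-elim (y≢w (sym e))
    injective {suc (suc (suc zero))}   {suc (suc zero)}         e = ⊥-elim (z≢w (sym e))
    injective {suc (suc (suc zero))}   {suc (suc (suc zero))}   _ = refl
    edges : ∀ (i : Fin 3) → Adjacent (f (F.inject₁ i)) (f (suc i))
    edges zero             = xy
    edges (suc zero)       = yz
    edges (suc (suc zero)) = zw

  -- Along a cycle x₀ x₁ x₂ … xⱼ, the edges x₀x₁, x₁x₂ and xⱼx₀ cannot all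
  -- contain c without repeating a vertex.
  star⇒acyclic : ∀ c → (∀ {x y} → Adjacent x y → x ≡ c ⊎ y ≡ c) → GirthInf
  star⇒acyclic c star zero                (() , _)
  star⇒acyclic c star (suc zero)          (s≤s () , _)
  star⇒acyclic c star (suc (suc zero))    (s≤s (s≤s ()) , _)
  star⇒acyclic c star (suc (suc (suc j))) (_ , f , injective , edges , closing)
    with star (edges (suc zero))
  ... | inj₂ f₂≡c with star (edges zero)
  ...   | inj₁ f₀≡c = 0≢2 (injective (trans f₀≡c (sym f₂≡c)))
    where
    0≢2 : Fin.zero {suc (suc j)} ≢ suc (suc zero)
    0≢2 ()
  ...   | inj₂ f₁≡c = 1≢2 (injective (trans f₁≡c (sym f₂≡c)))
    where
    1≢2 : Fin.suc (Fin.zero {suc j}) ≢ suc (suc zero)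
    1≢2 ()
  star⇒acyclic c star (suc (suc (suc j))) (_ , f , injective , edges , closing)
      | inj₁ f₁≡c with star closing
  ... | inj₁ fⱼ≡c = j≢1 (injective (trans fⱼ≡c (sym f₁≡c)))
    where
    j≢1 : F.fromℕ (suc (suc j)) ≢ suc zero
    j≢1 ()
  ... | inj₂ f₀≡c = 0≢1 (injective (trans f₀≡c (sym f₁≡c)))
    where
    0≢1 : Fin.zero {suc (suc j)} ≢ suc zero
    0≢1 ()

  ¬triangle⇒no-cycle-below-four : ¬ HasCycle 3 → ∀ l → l < 4 → ¬ HasCycle l
  ¬triangle⇒no-cycle-below-four ¬c₃ 0 _ (() , _)
  ¬triangle⇒no-cycle-below-four ¬c₃ 1 _ (s≤s () , _)
  ¬triangle⇒no-cycle-below-four ¬c₃ 2 _ (s≤s (s≤s ()) , _)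
  ¬triangle⇒no-cycle-below-four ¬c₃ 3 _ c₃ = ¬c₃ c₃
  ¬triangle⇒no-cycle-below-four ¬c₃ (suc (suc (suc (suc _)))) (s≤s (s≤s (s≤s (s≤s ()))))

inj₁-injective : ∀ {X Y : Set} {x y : X} → inj₁ {B = Y} x ≡ inj₁ y → x ≡ y
inj₁-injective refl = refl

inj₂≢inj₁ : ∀ {X Y : Set} {x : X} {y : Y} → inj₂ y ≢ inj₁ x
inj₂≢inj₁ ()

chain-count-positive : ∀ {n} → Adj n → 1 ≤ n
chain-count-positive (chain _)         = s≤s z≤n
chain-count-positive (adj _ _ _ _ _ _) = s≤s z≤n

bot-minimum : ∀ {n} (A : Adj n) x → Le A (bot A) x
bot-minimum (chain k)         x        = z≤n
bot-minimum (adj A a b _ _ k) (inj₁ x) = bot-minimum A x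
bot-minimum (adj A a b _ _ k) (inj₂ x) = bot-minimum A a

Lt⇒≢bot : ∀ {n} (A : Adj n) {a b} → Lt A a b → b ≢ bot A
Le-bot⇒≡bot : ∀ {n} (A : Adj n) {w} → Le A w (bot A) → w ≡ bot A
Le-bot⇒≡bot (chain k)                {w}      le = FP.≤-antisym le z≤n
Le-bot⇒≡bot (adj A a b _ _ k)        {inj₁ w} le = cong inj₁ (Le-bot⇒≡bot A le)
Le-bot⇒≡bot (adj A a b p _ k)        {inj₂ w} le = ⊥-elim (Lt⇒≢bot A p (Le-bot⇒≡bot A le))

Lt⇒≢bot A {a} (a≤b , a≢b) b≡bot =
  a≢b (trans (Le-bot⇒≡bot A (subst (Le A a) b≡bot a≤b)) (sym b≡bot))

Disjoint : ∀ {n} (A : Adj n) → Elt A → Elt A → Set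
Disjoint A u v = ∀ w → Le A w u → Le A w v → w ≡ bot A

IsZeroDivisor : ∀ {n} (A : Adj n) → Elt A → Set
IsZeroDivisor A u = u ≢ bot A × ∃ λ v → v ≢ bot A × Disjoint A u v

IsAtom : ∀ {n} (A : Adj n) → Elt A → Set
IsAtom A u = u ≢ bot A × (∀ w → Le A w u → w ≡ bot A ⊎ w ≡ u)

atoms-disjoint : ∀ {n} (A : Adj n) {u v} → IsAtom A u → IsAtom A v → u ≢ v → Disjoint A u v
atoms-disjoint A (_ , atom-u) (_ , atom-v) u≢v w w≤u w≤v with atom-u w w≤u | atom-v w w≤v
... | inj₁ w≡bot | _          = w≡bot
... | inj₂ _     | inj₁ w≡bot = w≡bot
... | inj₂ w≡u   | inj₂ w≡v   = ⊥-elim (u≢v (trans (sym w≡u) w≡v))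

Disjoint-sym : ∀ {n} (A : Adj n) {u v} → Disjoint A u v → Disjoint A v u
Disjoint-sym A disj w w≤v w≤u = disj w w≤u w≤v

Disjoint-inj₁ : ∀ {n} (A : Adj n) {a b p q k u v} →
                Disjoint A u v → Disjoint (adj A a b p q k) (inj₁ u) (inj₁ v)
Disjoint-inj₁ A             disj (inj₁ w) w≤u w≤v = cong inj₁ (disj w w≤u w≤v)
Disjoint-inj₁ A {b = b} {p} disj (inj₂ w) b≤u b≤v = ⊥-elim (Lt⇒≢bot A p (disj b b≤u b≤v))

inj₁-inj₂-disjoint : ∀ {n} (A : Adj n) {b} p q k {u} j → ¬ Le A b u →
                     Disjoint (adj A (bot A) b p q k) (inj₁ u) (inj₂ j)
inj₁-inj₂-disjoint A p q k j b≰u (inj₁ w) _   w≤bot = cong inj₁ (Le-bot⇒≡bot A w≤bot)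
inj₁-inj₂-disjoint A p q k j b≰u (inj₂ w) b≤u _     = ⊥-elim (b≰u b≤u)

module _ {n} (A : Adj n) {b : Elt A} (p : Lt A (bot A) b) (q : ¬ Covers A (bot A) b) where

  ¬Covers⇒≰atom : ∀ {t} → IsAtom A t → ¬ Le A b t
  ¬Covers⇒≰atom (_ , atom-t) b≤t with atom-t b b≤t
  ... | inj₁ b≡bot = proj₂ p (sym b≡bot)
  ... | inj₂ refl  = q (p , nothing-between)
    where
    nothing-between : ∀ z → Lt A (bot A) z → Lt A z b → ⊥
    nothing-between z (_ , bot≢z) (z≤b , z≢b) = [ (λ e → bot≢z (sym e)) , z≢b ]′ (atom-t z z≤b)

  module _ (k : ℕ) where
    private
      A′ = adj A (bot A) b p q k

    inj₂-zero-atom : IsAtom A′ (inj₂ zero)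
    inj₂-zero-atom = inj₂≢inj₁ , below
      where
      below : ∀ w → Le A′ w (inj₂ zero) → w ≡ inj₁ (bot A) ⊎ w ≡ inj₂ zero
      below (inj₁ w) le = inj₁ (cong inj₁ (Le-bot⇒≡bot A le))
      below (inj₂ w) le = inj₂ (cong inj₂ (FP.≤-antisym le z≤n))

    inj₁-atom : ∀ {t} → IsAtom A t → IsAtom A′ (inj₁ t)
    inj₁-atom {t} (t≢bot , atom-t) = (λ e → t≢bot (inj₁-injective e)) , below
      where
      below : ∀ w → Le A′ w (inj₁ t) → w ≡ inj₁ (bot A) ⊎ w ≡ inj₁ t
      below (inj₁ w) le with atom-t w le
      ... | inj₁ e = inj₁ (cong inj₁ e)
      ... | inj₂ e = inj₂ (cong inj₁ e)
      below (inj₂ w) le = ⊥-elim (¬Covers⇒≰atom (t≢bot , atom-t) le)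

zero⋖one : ∀ {k} → Lt (chain (suc k)) zero (suc zero) → Covers (chain (suc k)) zero (suc zero)
zero⋖one p = p , nothing-between
  where
  nothing-between : ∀ z → Lt (chain _) zero z → Lt (chain _) z (suc zero) → ⊥
  nothing-between zero          (_ , 0≢0) _          = 0≢0 refl
  nothing-between (suc zero)    _         (_ , 1≢1) = 1≢1 refl
  nothing-between (suc (suc z)) _         (s≤s () , _)

atom-exists : ∀ {n} (A : Adj n) → LowerDism A → ∀ {b} → Lt A (bot A) b → ∃ (IsAtom A)
atom-exists (chain zero)      _        {zero} (_ , 0≢0) = ⊥-elim (0≢0 refl)
atom-exists (chain (suc k))   _        _                 = suc zero , (λ ()) , below
  where
  below : ∀ (w : Fin (suc (suc k))) → w F.≤ Fin.suc (Fin.zero {k}) → w ≡ zero ⊎ w ≡ suc zero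
  below zero             _           = inj₁ refl
  below (suc zero)       _           = inj₂ refl
  below (suc (suc w))    (s≤s ())
atom-exists (adj A _ b p q k) (_ , refl) _ = inj₂ zero , inj₂-zero-atom A p q k

comparable-above-nonzero : ∀ {n} (A : Adj n) → LowerDism A → ∀ {w x y} → w ≢ bot A →
                           Le A w x → Le A w y → Le A x y ⊎ Le A y x
comparable-above-nonzero (chain k) _ {x = x} {y} _ _ _ = FP.≤-total x y
comparable-above-nonzero (adj A a b p q k) (ld , refl) = go
  where
  A′ = adj A (bot A) b p q k
  go : ∀ {w x y} → w ≢ inj₁ (bot A) → Le A′ w x → Le A′ w y → Le A′ x y ⊎ Le A′ y x
  go {inj₁ w} {inj₁ x} {inj₁ y} w≢bot wx wy =
    comparable-above-nonzero A ld (λ e → w≢bot (cong inj₁ e)) wx wy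
  go {inj₁ w} {inj₁ x} {inj₂ y} w≢bot wx wy = ⊥-elim (w≢bot (cong inj₁ (Le-bot⇒≡bot A wy)))
  go {inj₁ w} {inj₂ x} {y}      w≢bot wx wy = ⊥-elim (w≢bot (cong inj₁ (Le-bot⇒≡bot A wx)))
  go {inj₂ w} {inj₁ x} {inj₁ y} _     wx wy =
    comparable-above-nonzero A ld (λ e → proj₂ p (sym e)) wx wy
  go {inj₂ w} {inj₁ x} {inj₂ y} _     wx wy = inj₂ wx
  go {inj₂ w} {inj₂ x} {inj₁ y} _     wx wy = inj₁ wy
  go {inj₂ w} {inj₂ x} {inj₂ y} _     wx wy = FP.≤-total x y

OnlyZeroOne⇒LowerDism : ∀ {n} (A : Adj n) → OnlyZeroOne A → LowerDism A
OnlyZeroOne⇒LowerDism (chain k)         _                = tt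
OnlyZeroOne⇒LowerDism (adj A a b p q k) (oz , a≡bot , _) = OnlyZeroOne⇒LowerDism A oz , a≡bot

module Transport (L : FinLattice) {n} (A : Adj n) (I : L ≅Adj A) where
  open FinLattice L renaming (_≤_ to _⊑_)
  open MeetProperties L
  open ZeroDivisorGraph L
  open GraphProperties L
  open OrderIsoProperties I

  from-bot : from (bot A) ≡ 𝟘
  from-bot = LatticeIso.from-least L I (bot-minimum A)

  to-≢𝟘 : ∀ {x} → x ≢ 𝟘 → to x ≢ bot A
  to-≢𝟘 {x} x≢𝟘 e = x≢𝟘 (trans (sym (from∘to x)) (trans (cong from e) from-bot))

  from-≢bot : ∀ {u} → u ≢ bot A → from u ≢ 𝟘
  from-≢bot u≢bot e = u≢bot (from-injective (trans e (sym from-bot)))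

  Disjoint⇒∧≡𝟘 : ∀ {u v} → Disjoint A u v → from u ∧ from v ≡ 𝟘
  Disjoint⇒∧≡𝟘 {u} {v} disj = trans (sym (from∘to m)) (trans (cong from to-m≡bot) from-bot)
    where
    m = from u ∧ from v
    below : ∀ {w} → m ⊑ from w → Le A (to m) w
    below le = from-reflect (subst (_⊑ _) (sym (from∘to m)) le)
    to-m≡bot : to m ≡ bot A
    to-m≡bot = disj (to m) (below (x∧y≤x _ _)) (below (x∧y≤y _ _))

  Disjoint⇒Adjacent : ∀ {u v} → u ≢ bot A → v ≢ bot A → Disjoint A u v → Adjacent (from u) (from v)
  Disjoint⇒Adjacent u≢bot v≢bot disj =
    ∧≡𝟘⇒Adjacent (from-≢bot u≢bot) (from-≢bot v≢bot) (Disjoint⇒∧≡𝟘 disj)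

  zero-divisor-vertex : ∀ {u} → IsZeroDivisor A u → IsVertex (from u)
  zero-divisor-vertex (u≢bot , _ , v≢bot , disj) = proj₁ (Disjoint⇒Adjacent u≢bot v≢bot disj)

  atoms-adjacent : ∀ {u v} → IsAtom A u → IsAtom A v → u ≢ v → Adjacent (from u) (from v)
  atoms-adjacent at-u at-v u≢v =
    Disjoint⇒Adjacent (proj₁ at-u) (proj₁ at-v) (atoms-disjoint A at-u at-v u≢v)

  ∧≢𝟘⇒comparable : LowerDism A → ∀ {x y} → x ∧ y ≢ 𝟘 → x ⊑ y ⊎ y ⊑ x
  ∧≢𝟘⇒comparable ld {x} {y} x∧y≢𝟘 =
    ⊎-map to-reflect to-reflect
      (comparable-above-nonzero A ld (to-≢𝟘 x∧y≢𝟘) (to-mono (x∧y≤x x y)) (to-mono (x∧y≤y x y)))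

module LowerDismantlable (L : FinLattice) where
  open FinLattice L renaming (_≤_ to _⊑_)
  open ZeroDivisorGraph L
  open GraphProperties L

  vertices-nonempty : ∀ {n} (A : Adj n) → 2 ≤ n → LowerDism A → L ≅Adj A → VNonEmpty
  vertices-nonempty (chain _)         (s≤s ())
  vertices-nonempty (adj A _ b p q k) _ (ld , refl) I with atom-exists A ld p
  ... | t , atom-t =
    OrderIso.from I (inj₂ zero) ,
    proj₁ (atoms-adjacent (inj₂-zero-atom A p q k) (inj₁-atom A p q k atom-t) inj₂≢inj₁)
    where open Transport L _ I

  diameter≤2 : ∀ {n} (A : Adj n) → LowerDism A → L ≅Adj A → DiamLe 2
  diameter≤2 A ld I x y vx vy with (x ∧ y) FP.≟ 𝟘
  ... | yes x∧y≡𝟘 = 1 , s≤s z≤n , step (∧≡𝟘⇒Adjacent (proj₁ vx) (proj₁ vy) x∧y≡𝟘) here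
  ... | no x∧y≢𝟘 =
    2 , NP.≤-refl , comparable⇒Walk₂ (Transport.∧≢𝟘⇒comparable L A I ld x∧y≢𝟘) vx vy

  triangle : ∀ {n} (A : Adj n) → 3 ≤ n → LowerDism A → L ≅Adj A → HasCycle 3
  triangle (chain _)                   (s≤s ())
  triangle (adj (chain _) _ _ _ _ _)   (s≤s (s≤s ()))
  triangle (adj (adj B _ b′ p′ q′ k′) _ b p q k) _ ((ld , refl) , refl) I
    with atom-exists B ld p′
  ... | t , atom-t = cycle₃ (atoms-adjacent x₁ x₂ (λ ())) (atoms-adjacent x₂ x₃ (λ ()))
                            (atoms-adjacent x₃ x₁ (λ ()))
    where
    B′ = adj B (bot B) b′ p′ q′ k′
    open Transport L _ I
    x₁ = inj₂-zero-atom B′ p q k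
    x₂ = inj₁-atom B′ p q k (inj₂-zero-atom B p′ q′ k′)
    x₃ = inj₁-atom B′ p q k (inj₁-atom B p′ q′ k′ atom-t)

  triangle-or-two-chains : ∀ {n} (A : Adj n) → 2 ≤ n → LowerDism A → L ≅Adj A →
                           (3 ≤ n × HasCycle 3) ⊎ (n ≡ 2 × TwoChainAdj L (λ _ → ⊤))
  triangle-or-two-chains (chain _) (s≤s ()) _ _
  triangle-or-two-chains (adj (chain k) _ b p q k₂) _ (_ , refl) I =
    inj₂ (refl , k , b , p , q , k₂ , tt , I)
  triangle-or-two-chains A@(adj (adj B _ _ _ _ _) _ _ _ _ _) _ ld I =
    inj₁ (3≤n , triangle A 3≤n ld I)
    where
    3≤n = s≤s (s≤s (chain-count-positive B))

-- Adjuncts of two chains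

module TwoChains (L : FinLattice) {k k₂ : ℕ} {b : Fin (suc k)}
                 (p : Lt (chain k) zero b) (q : ¬ Covers (chain k) zero b)
                 (I : L ≅Adj adj (chain k) zero b p q k₂) where
  open ZeroDivisorGraph L
  open GraphProperties L
  open OrderIsoProperties I
  open Transport L _ I

  T : Adj 2
  T = adj (chain k) zero b p q k₂

  in-C₁ : Elt T → Bool
  in-C₁ (inj₁ _) = true
  in-C₁ (inj₂ _) = false

  same-chain⇒comparable : ∀ u v → in-C₁ u ≡ in-C₁ v → Le T u v ⊎ Le T v u
  same-chain⇒comparable (inj₁ x) (inj₁ y) _ = FP.≤-total x y
  same-chain⇒comparable (inj₂ x) (inj₂ y) _ = FP.≤-total x y

  Adjacent⇒different-chains : ∀ {x y} → Adjacent x y → in-C₁ (to x) ≢ in-C₁ (to y)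
  Adjacent⇒different-chains {x} {y} xy same with same-chain⇒comparable (to x) (to y) same
  ... | inj₁ le = Adjacent⇒⋢ xy (to-reflect le)
  ... | inj₂ le = Adjacent⇒⋢ (Adjacent-sym xy) (to-reflect le)

  no-triangle : ¬ HasCycle 3
  no-triangle (_ , f , _ , edges , closing) = different₂₀ (trans s₂≡¬s₁ (sym s₀≡¬s₁))
    where
    side : Fin 3 → Bool
    side i = in-C₁ (to (f i))
    s₀≡¬s₁ : side zero ≡ not (side (suc zero))
    s₀≡¬s₁ = ¬-not (Adjacent⇒different-chains (edges zero))
    s₂≡¬s₁ : side (suc (suc zero)) ≡ not (side (suc zero))
    s₂≡¬s₁ = ¬-not (λ e → Adjacent⇒different-chains (edges (suc zero)) (sym e))
    different₂₀ = Adjacent⇒different-chains closing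

  C₁-C₂-adjacent : ∀ {i} j → i ≢ zero → ¬ b F.≤ i → Adjacent (from (inj₁ i)) (from (inj₂ j))
  C₁-C₂-adjacent j i≢0 b≰i =
    Disjoint⇒Adjacent (λ e → i≢0 (inj₁-injective e)) inj₂≢inj₁
                      (inj₁-inj₂-disjoint (chain k) p q k₂ j b≰i)

module _ (L : FinLattice) where
  open ZeroDivisorGraph L
  open GraphProperties L

  singleton-C₂⇒acyclic : ∀ {k} {b : Fin (suc k)} p q → L ≅Adj adj (chain k) zero b p q 0 → GirthInf
  singleton-C₂⇒acyclic p q I = star⇒acyclic (from (inj₂ zero)) star
    where
    open TwoChains L p q I
    open OrderIsoProperties I
    centre : ∀ {x} → to x ≡ inj₂ zero ⊎ in-C₁ (to x) ≡ true
    centre {x} with to x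
    ... | inj₂ zero = inj₁ refl
    ... | inj₁ _    = inj₂ refl
    is-centre : ∀ {x} → to x ≡ inj₂ zero → x ≡ from (inj₂ zero)
    is-centre {x} e = trans (sym (from∘to x)) (cong from e)
    star : ∀ {x y} → Adjacent x y → x ≡ from (inj₂ zero) ⊎ y ≡ from (inj₂ zero)
    star {x} {y} xy with centre {x} | centre {y}
    ... | inj₁ e  | _       = inj₁ (is-centre e)
    ... | _       | inj₁ e  = inj₂ (is-centre e)
    ... | inj₂ sx | inj₂ sy = ⊥-elim (Adjacent⇒different-chains xy (trans sx (sym sy)))

  four-cycle : ∀ {k k₂} {b : Fin (suc k)} p q →
               L ≅Adj adj (chain (3 + k)) zero (suc (suc (suc b))) p q (suc k₂) → HasCycle 4
  four-cycle p q I =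
    cycle₄
      (C₁-C₂-adjacent zero (λ ()) b≰1)
      (Adjacent-sym (C₁-C₂-adjacent zero (λ ()) b≰2))
      (C₁-C₂-adjacent (suc zero) (λ ()) b≰2)
      (Adjacent-sym (C₁-C₂-adjacent (suc zero) (λ ()) b≰1))
      (λ e → 1≢2 (from-injective e)) (λ e → 0≢1 (from-injective e))
    where
    open TwoChains L p q I
    open OrderIsoProperties I
    b≰1 = λ { (s≤s ()) }
    b≰2 = λ { (s≤s (s≤s ())) }
    1≢2 : inj₁ (suc zero) ≢ inj₁ (suc (suc zero))
    1≢2 ()
    0≢1 : inj₂ zero ≢ inj₂ (suc zero)
    0≢1 ()

↑ˡ-≤-iff : ∀ {m} n {i j : Fin m} → (i ↑ˡ n) F.≤ (j ↑ˡ n) ⇔ i F.≤ j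
↑ˡ-≤-iff n {i} {j} = mk⇔ (subst₂ _≤_ (FP.toℕ-↑ˡ i n) (FP.toℕ-↑ˡ j n))
                         (subst₂ _≤_ (sym (FP.toℕ-↑ˡ i n)) (sym (FP.toℕ-↑ˡ j n)))

↑ʳ-≤-iff : ∀ m {n} {i j : Fin n} → (m ↑ʳ i) F.≤ (m ↑ʳ j) ⇔ i F.≤ j
↑ʳ-≤-iff zero    = mk⇔ (λ le → le) (λ le → le)
↑ʳ-≤-iff (suc m) = mk⇔ (λ le → Equivalence.to (↑ʳ-≤-iff m) (s≤s⁻¹ le))
                       (λ le → s≤s (Equivalence.from (↑ʳ-≤-iff m) le))

↑ˡ<↑ʳ : ∀ {m n} (i : Fin m) (j : Fin n) → (i ↑ˡ n) F.< (m ↑ʳ j)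
↑ˡ<↑ʳ {m} {n} i j = subst₂ _<_ (sym (FP.toℕ-↑ˡ i n)) (sym (FP.toℕ-↑ʳ m j))
                           (NP.<-≤-trans (FP.toℕ<n i) (NP.m≤m+n m (toℕ j)))

-- For b = 2 the atom 1 of C₁ can be split off instead of C₂:
-- C₁ ]₀² C₂ ≅ C′ ]₀^{a′} {1}  with  C′ = 0 < C₂ < 2 < 3 < ⋯ < top C₁.
module Reglue {k′ k₂ : ℕ} (p : Lt (chain (2 + k′)) zero (suc (suc zero)))
              (q : ¬ Covers (chain (2 + k′)) zero (suc (suc zero))) where

  K : ℕ
  K = suc k₂ + suc k′

  a′ : Fin (suc K)
  a′ = suc (suc k₂ ↑ʳ zero)

  p′ : Lt (chain K) zero a′
  p′ = z≤n , λ ()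

  q′ : ¬ Covers (chain K) zero a′
  q′ (_ , nothing-between) = nothing-between (suc zero) (z≤n , λ ()) (s≤s z≤n , λ ())

  T : Adj 2
  T = adj (chain (2 + k′)) zero (suc (suc zero)) p q k₂

  T′ : Adj 2
  T′ = adj (chain K) zero a′ p′ q′ 0

  φ : Elt T → Elt T′
  φ (inj₁ zero)          = inj₁ zero
  φ (inj₁ (suc zero))    = inj₂ zero
  φ (inj₁ (suc (suc i))) = inj₁ (suc (suc k₂ ↑ʳ i))
  φ (inj₂ j)             = inj₁ (suc (j ↑ˡ suc k′))

  ψ-C′ : Fin (suc k₂) ⊎ Fin (suc k′) → Elt T
  ψ-C′ (inj₁ j) = inj₂ j
  ψ-C′ (inj₂ i) = inj₁ (suc (suc i))

  ψ : Elt T′ → Elt T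
  ψ (inj₁ zero)    = inj₁ zero
  ψ (inj₁ (suc y)) = ψ-C′ (splitAt (suc k₂) y)
  ψ (inj₂ _)       = inj₁ (suc zero)

  φ∘ψ-C′ : ∀ s → φ (ψ-C′ s) ≡ inj₁ (suc (join (suc k₂) (suc k′) s))
  φ∘ψ-C′ (inj₁ j) = refl
  φ∘ψ-C′ (inj₂ i) = refl

  ψ∘φ : ∀ u → ψ (φ u) ≡ u
  ψ∘φ (inj₁ zero)          = refl
  ψ∘φ (inj₁ (suc zero))    = refl
  ψ∘φ (inj₁ (suc (suc i))) = cong ψ-C′ (FP.splitAt-↑ʳ (suc k₂) (suc k′) i)
  ψ∘φ (inj₂ j)             = cong ψ-C′ (FP.splitAt-↑ˡ (suc k₂) j (suc k′))

  φ∘ψ : ∀ v → φ (ψ v) ≡ v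
  φ∘ψ (inj₁ zero)    = refl
  φ∘ψ (inj₁ (suc y)) = trans (φ∘ψ-C′ (splitAt (suc k₂) y))
                             (cong (λ z → inj₁ (suc z)) (FP.join-splitAt (suc k₂) (suc k′) y))
  φ∘ψ (inj₂ zero)    = refl

  φ-mono : ∀ u v → Le T u v ⇔ Le T′ (φ u) (φ v)
  φ-mono (inj₁ zero)          v                     =
    mk⇔ (λ _ → bot-minimum T′ (φ v)) (λ _ → bot-minimum T v)
  φ-mono (inj₁ (suc zero))    (inj₁ zero)           = mk⇔ (λ ()) (λ ())
  φ-mono (inj₁ (suc zero))    (inj₁ (suc zero))     = mk⇔ (λ _ → z≤n) (λ _ → s≤s z≤n)
  φ-mono (inj₁ (suc zero))    (inj₁ (suc (suc i)))  =
    mk⇔ (λ _ → s≤s (Equivalence.from (↑ʳ-≤-iff (suc k₂)) z≤n)) (λ _ → s≤s z≤n)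
  φ-mono (inj₁ (suc zero))    (inj₂ j)              =
    mk⇔ (λ ()) (λ le → ⊥-elim (NP.<⇒≱ (↑ˡ<↑ʳ j zero) (s≤s⁻¹ le)))
  φ-mono (inj₁ (suc (suc i))) (inj₁ zero)           = mk⇔ (λ ()) (λ ())
  φ-mono (inj₁ (suc (suc i))) (inj₁ (suc zero))     = mk⇔ (λ { (s≤s ()) }) (λ ())
  φ-mono (inj₁ (suc (suc i))) (inj₁ (suc (suc i′))) =
    mk⇔ (λ le → s≤s (Equivalence.from (↑ʳ-≤-iff (suc k₂)) (s≤s⁻¹ (s≤s⁻¹ le))))
        (λ le → s≤s (s≤s (Equivalence.to (↑ʳ-≤-iff (suc k₂)) (s≤s⁻¹ le))))
  φ-mono (inj₁ (suc (suc i))) (inj₂ j)              =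
    mk⇔ (λ ()) (λ le → ⊥-elim (NP.<⇒≱ (↑ˡ<↑ʳ j i) (s≤s⁻¹ le)))
  φ-mono (inj₂ j)             (inj₁ zero)           = mk⇔ (λ ()) (λ ())
  φ-mono (inj₂ j)             (inj₁ (suc zero))     = mk⇔ (λ { (s≤s ()) }) (λ ())
  φ-mono (inj₂ j)             (inj₁ (suc (suc i)))  =
    mk⇔ (λ _ → s≤s (NP.<⇒≤ (↑ˡ<↑ʳ j i))) (λ _ → s≤s (s≤s z≤n))
  φ-mono (inj₂ j)             (inj₂ j′)             =
    mk⇔ (λ le → s≤s (Equivalence.from (↑ˡ-≤-iff (suc k′)) le))
        (λ le → Equivalence.to (↑ˡ-≤-iff (suc k′)) (s≤s⁻¹ le))

  reglue : OrderIso (Le T) (Le T′)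
  reglue = record { to = φ ; from = ψ ; from∘to = ψ∘φ ; to∘from = φ∘ψ ; mono = φ-mono }

module _ (L : FinLattice) where
  open ZeroDivisorGraph L

  reglued-or-four-cycle : ∀ {k k₂} {b : Fin (suc k)} p q → L ≅Adj adj (chain k) zero b p q (suc k₂) →
                          TwoChainAdj L (_≡ 1) ⊎ HasCycle 4
  reglued-or-four-cycle {b = zero}                p _ _ = ⊥-elim (proj₂ p refl)
  reglued-or-four-cycle {suc k} {b = suc zero}    p q _ = ⊥-elim (q (zero⋖one p))
  reglued-or-four-cycle {suc (suc k)} {b = suc (suc zero)} p q I =
    inj₁ (K , a′ , p′ , q′ , 0 , refl , reglue ∘-OrderIso I)
    where open Reglue p q
  reglued-or-four-cycle {suc (suc (suc k))} {b = suc (suc (suc b))} p q I = inj₂ (four-cycle L p q I)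

-- The lattices Mₙ

liftM : ∀ {m} → MElt m → MElt (suc m)
liftM m0       = m0
liftM m1       = m1
liftM (atom i) = atom (suc i)

liftM-mono : ∀ {m} (c d : MElt m) → LeM c d ⇔ LeM (liftM c) (liftM d)
liftM-mono m0       d        = mk⇔ (λ _ → tt) (λ _ → tt)
liftM-mono m1       m0       = mk⇔ (λ ()) (λ ())
liftM-mono m1       m1       = mk⇔ (λ _ → tt) (λ _ → tt)
liftM-mono m1       (atom j) = mk⇔ (λ ()) (λ ())
liftM-mono (atom i) m0       = mk⇔ (λ ()) (λ ())
liftM-mono (atom i) m1       = mk⇔ (λ _ → tt) (λ _ → tt)
liftM-mono (atom i) (atom j) = mk⇔ (cong suc) FP.suc-injective

liftM-below-atom₀ : ∀ {m} (c : MElt m) → LeM (liftM c) (atom zero) → c ≡ m0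
liftM-below-atom₀ m0 _ = refl

liftM-above-atom₀ : ∀ {m} (c : MElt m) → LeM (atom zero) (liftM c) → c ≡ m1
liftM-above-atom₀ m1 _ = refl

m1-maximal : ∀ {m} (c : MElt m) → LeM m1 c → c ≡ m1
m1-maximal m1 _ = refl

m1-greatest : ∀ {m} (c : MElt m) → LeM c m1
m1-greatest m0       = tt
m1-greatest m1       = tt
m1-greatest (atom _) = tt

below-two-atoms : ∀ {m} (c : MElt m) {i j} → LeM c (atom i) → LeM c (atom j) → i ≢ j → c ≡ m0
below-two-atoms m0       _    _    _   = refl
below-two-atoms (atom _) refl refl i≢i = ⊥-elim (i≢i refl)

-- C₀ = 0 < a₁ < 1 and every further chain is a single atom glued between 0 and 1.
IsMₙShape : ∀ {n} → Adj n → Set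
IsMₙShape (chain k)         = k ≡ 2
IsMₙShape (adj A _ _ _ _ k) = IsMₙShape A × k ≡ 0

toMₙ : ∀ {n} (A : Adj n) → IsMₙShape A → Elt A → MElt n
toMₙ (chain _)         refl     zero             = m0
toMₙ (chain _)         refl     (suc zero)       = atom zero
toMₙ (chain _)         refl     (suc (suc zero)) = m1
toMₙ (adj A _ _ _ _ _) (s , _)  (inj₁ x)         = liftM (toMₙ A s x)
toMₙ (adj A _ _ _ _ _) (_ , refl) (inj₂ zero)    = atom zero

fromMₙ : ∀ {n} (A : Adj n) → IsMₙShape A → MElt n → Elt A
fromMₙ (chain _)         refl    m0              = zero
fromMₙ (chain _)         refl    (atom zero)     = suc zero
fromMₙ (chain _)         refl    m1              = suc (suc zero)
fromMₙ (adj A _ _ _ _ _) (s , _) m0              = inj₁ (fromMₙ A s m0)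
fromMₙ (adj A _ _ _ _ _) (s , _) m1              = inj₁ (fromMₙ A s m1)
fromMₙ (adj A _ _ _ _ _) (s , _) (atom zero)     = inj₂ zero
fromMₙ (adj A _ _ _ _ _) (s , _) (atom (suc i))  = inj₁ (fromMₙ A s (atom i))

toMₙ-bot : ∀ {n} (A : Adj n) s → toMₙ A s (bot A) ≡ m0
toMₙ-bot (chain _)         refl    = refl
toMₙ-bot (adj A _ _ _ _ _) (s , _) = cong liftM (toMₙ-bot A s)

toMₙ-top : ∀ {n} (A : Adj n) s → toMₙ A s (top A) ≡ m1
toMₙ-top (chain _)         refl    = refl
toMₙ-top (adj A _ _ _ _ _) (s , _) = cong liftM (toMₙ-top A s)

fromMₙ-liftM : ∀ {n} (A : Adj n) {a b p q k} s c →
               fromMₙ (adj A a b p q k) s (liftM c) ≡ inj₁ (fromMₙ A (proj₁ s) c)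
fromMₙ-liftM A s m0       = refl
fromMₙ-liftM A s m1       = refl
fromMₙ-liftM A s (atom i) = refl

fromMₙ∘toMₙ : ∀ {n} (A : Adj n) s x → fromMₙ A s (toMₙ A s x) ≡ x
fromMₙ∘toMₙ (chain _)         refl       zero             = refl
fromMₙ∘toMₙ (chain _)         refl       (suc zero)       = refl
fromMₙ∘toMₙ (chain _)         refl       (suc (suc zero)) = refl
fromMₙ∘toMₙ (adj A _ _ _ _ _) (s , refl) (inj₁ x)         =
  trans (fromMₙ-liftM A (s , refl) (toMₙ A s x)) (cong inj₁ (fromMₙ∘toMₙ A s x))
fromMₙ∘toMₙ (adj A _ _ _ _ _) (s , refl) (inj₂ zero)      = refl

toMₙ∘fromMₙ : ∀ {n} (A : Adj n) s c → toMₙ A s (fromMₙ A s c) ≡ c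
toMₙ∘fromMₙ (chain _)         refl       m0             = refl
toMₙ∘fromMₙ (chain _)         refl       (atom zero)    = refl
toMₙ∘fromMₙ (chain _)         refl       m1             = refl
toMₙ∘fromMₙ (adj A _ _ _ _ _) (s , refl) m0             = cong liftM (toMₙ∘fromMₙ A s m0)
toMₙ∘fromMₙ (adj A _ _ _ _ _) (s , refl) m1             = cong liftM (toMₙ∘fromMₙ A s m1)
toMₙ∘fromMₙ (adj A _ _ _ _ _) (s , refl) (atom zero)    = refl
toMₙ∘fromMₙ (adj A _ _ _ _ _) (s , refl) (atom (suc i)) = cong liftM (toMₙ∘fromMₙ A s (atom i))

toMₙ-mono : ∀ {n} (A : Adj n) → OnlyZeroOne A → ∀ s x y → Le A x y ⇔ LeM (toMₙ A s x) (toMₙ A s y)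
toMₙ-mono (chain _) _ refl zero             y                = mk⇔ (λ _ → tt) (λ _ → z≤n)
toMₙ-mono (chain _) _ refl (suc zero)       zero             = mk⇔ (λ ()) (λ ())
toMₙ-mono (chain _) _ refl (suc zero)       (suc zero)       = mk⇔ (λ _ → refl) (λ _ → s≤s z≤n)
toMₙ-mono (chain _) _ refl (suc zero)       (suc (suc zero)) = mk⇔ (λ _ → tt) (λ _ → s≤s z≤n)
toMₙ-mono (chain _) _ refl (suc (suc zero)) zero             = mk⇔ (λ ()) (λ ())
toMₙ-mono (chain _) _ refl (suc (suc zero)) (suc zero)       = mk⇔ (λ { (s≤s ()) }) (λ ())
toMₙ-mono (chain _) _ refl (suc (suc zero)) (suc (suc zero)) = mk⇔ (λ _ → tt) (λ _ → s≤s (s≤s z≤n))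
toMₙ-mono (adj A _ _ _ _ _) (oz , refl , refl) (s , refl) = mono
  where
  A′ = adj A (bot A) (top A) _ _ 0
  to = toMₙ A s
  IH = toMₙ-mono A oz s
  mono : ∀ x y → Le A′ x y ⇔ LeM (toMₙ A′ (s , refl) x) (toMₙ A′ (s , refl) y)
  mono (inj₁ x)    (inj₁ y)    = ⇔-trans (IH x y) (liftM-mono (to x) (to y))
  mono (inj₁ x)    (inj₂ zero) = mk⇔ below-atom₀ from-below-atom₀
    where
    below-atom₀ : Le A x (bot A) → LeM (liftM (to x)) (atom zero)
    below-atom₀ x≤bot = subst (λ c → LeM (liftM c) (atom zero))
                              (sym (trans (cong to (Le-bot⇒≡bot A x≤bot)) (toMₙ-bot A s))) tt
    from-below-atom₀ : LeM (liftM (to x)) (atom zero) → Le A x (bot A)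
    from-below-atom₀ le = Equivalence.from (IH x (bot A))
      (subst₂ LeM (sym (liftM-below-atom₀ (to x) le)) (sym (toMₙ-bot A s)) tt)
  mono (inj₂ zero) (inj₁ y)    = mk⇔ above-atom₀ from-above-atom₀
    where
    above-atom₀ : Le A (top A) y → LeM (atom zero) (liftM (to y))
    above-atom₀ top≤y = subst (λ c → LeM (atom zero) (liftM c)) (sym (m1-maximal (to y) m1≤to-y)) tt
      where
      m1≤to-y : LeM m1 (to y)
      m1≤to-y = subst (λ c → LeM c (to y)) (toMₙ-top A s) (Equivalence.to (IH (top A) y) top≤y)
    from-above-atom₀ : LeM (atom zero) (liftM (to y)) → Le A (top A) y
    from-above-atom₀ le = Equivalence.from (IH (top A) y)
      (subst₂ LeM (sym (toMₙ-top A s)) (sym (liftM-above-atom₀ (to y) le)) tt)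
  mono (inj₂ zero) (inj₂ zero) = mk⇔ (λ _ → refl) (λ _ → z≤n)

Mₙ-iso : ∀ {n} (A : Adj n) → OnlyZeroOne A → IsMₙShape A → OrderIso (Le A) (LeM {n})
Mₙ-iso A oz s = record
  { to = toMₙ A s ; from = fromMₙ A s
  ; from∘to = fromMₙ∘toMₙ A s ; to∘from = toMₙ∘fromMₙ A s
  ; mono = toMₙ-mono A oz s
  }

ZeroDivisorsIncomparable : ∀ {n} → Adj n → Set
ZeroDivisorsIncomparable A =
  ∀ {u v} → IsZeroDivisor A u → IsZeroDivisor A v → Le A u v → u ≡ v

ZeroDivisorsIncomparable-inj₁ : ∀ {n} (A : Adj n) {a b p q k} →
  ZeroDivisorsIncomparable (adj A a b p q k) → ZeroDivisorsIncomparable A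
ZeroDivisorsIncomparable-inj₁ A incomparable zu zv u≤v =
  inj₁-injective (incomparable (lift zu) (lift zv) u≤v)
  where
  lift : ∀ {u} → IsZeroDivisor A u → IsZeroDivisor (adj A _ _ _ _ _) (inj₁ u)
  lift (u≢bot , v , v≢bot , disj) =
    (λ e → u≢bot (inj₁-injective e)) , inj₁ v , (λ e → v≢bot (inj₁-injective e)) , Disjoint-inj₁ A disj

last-chain-singleton : ∀ {n} (A : Adj n) → LowerDism A → ∀ {b} p q k →
                       ZeroDivisorsIncomparable (adj A (bot A) b p q k) → k ≡ 0
last-chain-singleton A ld p q zero    _            = refl
last-chain-singleton A ld p q (suc k) incomparable with atom-exists A ld p
... | t , atom-t = ⊥-elim (0≢1 (incomparable (divisor zero) (divisor (suc zero)) z≤n))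
  where
  divisor : ∀ j → IsZeroDivisor (adj A (bot A) _ p q (suc k)) (inj₂ j)
  divisor j = inj₂≢inj₁ , inj₁ t , (λ e → proj₁ atom-t (inj₁-injective e)) ,
              Disjoint-sym (adj A _ _ p q _)
                (inj₁-inj₂-disjoint A p q (suc k) j (¬Covers⇒≰atom A p q atom-t))
  0≢1 : inj₂ {A = Elt A} (Fin.zero {suc k}) ≢ inj₂ (suc zero)
  0≢1 ()

first-chain-three : ∀ {k₀} p q k →
                    ZeroDivisorsIncomparable (adj (chain k₀) zero (F.fromℕ k₀) p q k) → k₀ ≡ 2
first-chain-three {zero}              p _ _ _ = ⊥-elim (proj₂ p refl)
first-chain-three {suc zero}          p q _ _ = ⊥-elim (q (zero⋖one p))
first-chain-three {suc (suc zero)}    _ _ _ _ = refl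
first-chain-three {suc (suc (suc _))} p q k incomparable =
  ⊥-elim (1≢2 (incomparable (divisor zero (λ { (s≤s ()) }))
                             (divisor (suc zero) (λ { (s≤s (s≤s ())) })) (s≤s z≤n)))
  where
  divisor : ∀ i → ¬ F.fromℕ _ F.≤ suc i → IsZeroDivisor (adj (chain _) zero _ p q k) (inj₁ (suc i))
  divisor i top≰i = (λ ()) , inj₂ zero , inj₂≢inj₁ ,
                    inj₁-inj₂-disjoint (chain _) p q k zero top≰i
  1≢2 : inj₁ {B = Fin (suc k)} (suc zero) ≢ inj₁ (suc (suc zero))
  1≢2 ()

incomparable⇒IsMₙShape : ∀ {n} (A : Adj n) {a b p q k} → OnlyZeroOne (adj A a b p q k) →
                         ZeroDivisorsIncomparable (adj A a b p q k) → IsMₙShape (adj A a b p q k)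
incomparable⇒IsMₙShape (chain _) {p = p} {q} {k} (_ , refl , refl) incomparable =
  first-chain-three p q k incomparable , last-chain-singleton (chain _) tt p q k incomparable
incomparable⇒IsMₙShape A@(adj _ _ _ _ _ _) {p = p} {q} {k} (oz , refl , refl) incomparable =
  incomparable⇒IsMₙShape _ oz (ZeroDivisorsIncomparable-inj₁ A incomparable) ,
  last-chain-singleton A (OnlyZeroOne⇒LowerDism A oz) p q k incomparable

module _ (L : FinLattice) where
  open FinLattice L renaming (_≤_ to _⊑_)
  open ZeroDivisorGraph L
  open GraphProperties L

  diameter-one⇒incomparable : ∀ {n} (A : Adj n) → L ≅Adj A → DiamLe 1 → ZeroDivisorsIncomparable A
  diameter-one⇒incomparable A I diam≤1 {u} {v} zu zv u≤v =
    short-walk⇒≡ (diam≤1 (from u) (from v) (zero-divisor-vertex zu) (zero-divisor-vertex zv))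
    where
    open Transport L A I
    open OrderIsoProperties I
    short-walk⇒≡ : ∃ (λ k → k ≤ 1 × Walk (from u) (from v) k) → u ≡ v
    short-walk⇒≡ (zero , _ , walk)                = from-injective (Walk₀⇒≡ walk)
    short-walk⇒≡ (suc zero , _ , step edge here)  = ⊥-elim (Adjacent⇒⋢ edge (from-mono u≤v))
    short-walk⇒≡ (suc (suc _) , s≤s () , _)

  diameter-one⇒Mₙ : ∀ {n} (A : Adj n) → 2 ≤ n → OnlyZeroOne A → L ≅Adj A → DiamEq 1 → L ≅M n
  diameter-one⇒Mₙ (chain _)         (s≤s ())
  diameter-one⇒Mₙ (adj A _ _ _ _ _) _ oz I (diam≤1 , _) =
    Mₙ-iso _ oz (incomparable⇒IsMₙShape A oz (diameter-one⇒incomparable _ I diam≤1)) ∘-OrderIso I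

  module Mₙ-graph {n} (J : L ≅M (2 + n)) where
    open MeetProperties L
    open OrderIsoProperties J

    from-m0 : from m0 ≡ 𝟘
    from-m0 = LatticeIso.from-least L J (λ _ → tt)

    atoms-meet : ∀ {x y i j} → to x ≡ atom i → to y ≡ atom j → i ≢ j → x ∧ y ≡ 𝟘
    atoms-meet {x} {y} tx ty i≢j =
      trans (sym (from∘to (x ∧ y))) (trans (cong from to-x∧y≡m0) from-m0)
      where
      to-x∧y≡m0 : to (x ∧ y) ≡ m0
      to-x∧y≡m0 = below-two-atoms (to (x ∧ y)) (subst (LeM _) tx (to-mono (x∧y≤x x y)))
                                  (subst (LeM _) ty (to-mono (x∧y≤y x y))) i≢j

    vertex⇒atom : ∀ {x} → IsVertex x → ∃ λ i → to x ≡ atom i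
    vertex⇒atom {x} (x≢𝟘 , y , y≢𝟘 , x∧y≡𝟘) with to x in tx
    ... | atom i = i , refl
    ... | m0 = ⊥-elim (x≢𝟘 (trans (sym (from∘to x)) (trans (cong from tx) from-m0)))
    ... | m1 = ⊥-elim (y≢𝟘 (⊑-∧≡𝟘⇒≡𝟘 y⊑x (∧≡𝟘-sym x∧y≡𝟘)))
      where
      y⊑x : y ⊑ x
      y⊑x = to-reflect (subst (LeM (to y)) (sym tx) (m1-greatest (to y)))

    atom-≢𝟘 : ∀ i → from (atom i) ≢ 𝟘
    atom-≢𝟘 i e = m0≢atom (from-injective (trans from-m0 (sym e)))
      where
      m0≢atom : m0 ≢ atom i
      m0≢atom ()

    diameter-one : DiamEq 1
    diameter-one = diam≤1 , from (atom zero) , from (atom (suc zero)) ,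
                      proj₁ atoms-adjacent , proj₁ (proj₂ atoms-adjacent) , not-equal
      where
      diam≤1 : DiamLe 1
      diam≤1 x y vx vy with x FP.≟ y | vertex⇒atom vx | vertex⇒atom vy
      ... | yes refl | _ | _ = 0 , z≤n , here
      ... | no x≢y | i , tx | j , ty =
        1 , NP.≤-refl ,
        step (vx , vy , x≢y , atoms-meet tx ty (λ { refl → x≢y (to-injective (trans tx (sym ty))) }))
             here
      atoms-adjacent : Adjacent (from (atom zero)) (from (atom (suc zero)))
      atoms-adjacent = ∧≡𝟘⇒Adjacent (atom-≢𝟘 zero) (atom-≢𝟘 (suc zero))
                         (atoms-meet (to∘from (atom zero)) (to∘from (atom (suc zero))) (λ ()))
      not-equal : ∀ k → k < 1 → ¬ Walk (from (atom zero)) (from (atom (suc zero))) k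
      not-equal zero    _            walk = proj₁ (proj₂ (proj₂ atoms-adjacent)) (Walk₀⇒≡ walk)
      not-equal (suc _) (s≤s ())

  Mₙ⇒diameter-one : ∀ {n} → 2 ≤ n → L ≅M n → DiamEq 1
  Mₙ⇒diameter-one (s≤s (s≤s _)) J = Mₙ-graph.diameter-one J

-- Girth

module Girth (L : FinLattice) {n} (A : Adj n) (2≤n : 2 ≤ n) (ld : LowerDism A) (I : L ≅Adj A) where
  open ZeroDivisorGraph L
  open GraphProperties L
  open LowerDismantlable L

  girth-three⇔ : GirthEq 3 ⇔ 3 ≤ n
  girth-three⇔ with triangle-or-two-chains A 2≤n ld I
  ... | inj₁ (3≤n , c₃)      = mk⇔ (λ _ → 3≤n) (λ _ → c₃ , λ l l<3 (3≤l , _) → NP.<⇒≱ l<3 3≤l)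
  ... | inj₂ (refl , (_ , _ , p , q , _ , _ , J)) =
    mk⇔ (λ (c₃ , _) → ⊥-elim (TwoChains.no-triangle L p q J c₃)) (λ { (s≤s (s≤s ())) })

  girth-four⇔ : GirthEq 4 ⇔ (n ≡ 2 × (∀ s → TwoChainAdj L (λ m → m ≡ s) → 2 ≤ s))
  girth-four⇔ with triangle-or-two-chains A 2≤n ld I
  ... | inj₁ (3≤n , c₃) =
    mk⇔ (λ (_ , minimal) → ⊥-elim (minimal 3 NP.≤-refl c₃))
        (λ { (refl , _) → ⊥-elim (NP.<⇒≱ NP.≤-refl 3≤n) })
  ... | inj₂ (refl , (k , b , p , q , k₂ , _ , J)) = mk⇔ forward backward
    where
    forward : GirthEq 4 → 2 ≡ 2 × (∀ s → TwoChainAdj L (λ m → m ≡ s) → 2 ≤ s)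
    forward (c₄ , _) = refl , reps-large
      where
      reps-large : ∀ s → TwoChainAdj L (λ m → m ≡ s) → 2 ≤ s
      reps-large _ (_ , _ , p′ , q′ , zero  , refl , J′) = ⊥-elim (singleton-C₂⇒acyclic L p′ q′ J′ 4 c₄)
      reps-large _ (_ , _ , _  , _  , suc _ , refl , _)  = s≤s (s≤s z≤n)
    backward : 2 ≡ 2 × (∀ s → TwoChainAdj L (λ m → m ≡ s) → 2 ≤ s) → GirthEq 4
    backward (_ , reps-large) = girth-four k₂ J (reps-large (suc k₂) (k , b , p , q , k₂ , refl , J))
      where
      girth-four : ∀ k₂ → L ≅Adj adj (chain k) zero b p q k₂ → 2 ≤ suc k₂ → GirthEq 4
      girth-four zero     _ (s≤s ())
      girth-four (suc k₂) J _ with reglued-or-four-cycle L p q J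
      ... | inj₁ rep = ⊥-elim (NP.<⇒≱ NP.≤-refl (reps-large 1 rep))
      ... | inj₂ c₄  = c₄ , ¬triangle⇒no-cycle-below-four (TwoChains.no-triangle L p q J)

  girth-infinite⇔ : GirthInf ⇔ TwoChainAdj L (λ m → m ≡ 1)
  girth-infinite⇔ = mk⇔ forward backward
    where
    backward : TwoChainAdj L (λ m → m ≡ 1) → GirthInf
    backward (_ , _ , p , q , zero , refl , J) = singleton-C₂⇒acyclic L p q J
    forward : GirthInf → TwoChainAdj L (λ m → m ≡ 1)
    forward acyclic with triangle-or-two-chains A 2≤n ld I
    ... | inj₁ (_ , c₃) = ⊥-elim (acyclic 3 c₃)
    ... | inj₂ (_ , (k , b , p , q , zero , _ , J)) = k , b , p , q , zero , refl , J
    ... | inj₂ (_ , (k , b , p , q , suc _ , _ , J)) with reglued-or-four-cycle L p q J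
    ...   | inj₁ rep = rep
    ...   | inj₂ c₄  = ⊥-elim (acyclic 4 c₄)

theorem2p19 : (n : ℕ) → 2 ≤ n → (L : FinLattice) → (A : Adj n) →
              LowerDism A → L ≅Adj A →
              let open ZeroDivisorGraph L in
              (VNonEmpty × DiamLe 2)
              × (OnlyZeroOne A → (DiamEq 1 ⇔ L ≅M n))
              × (GirthEq 3 ⇔ 3 ≤ n)
              × (GirthEq 4 ⇔ (n ≡ 2 × (∀ s → TwoChainAdj L (λ m → m ≡ s) → 2 ≤ s)))
              × (GirthInf ⇔ TwoChainAdj L (λ m → m ≡ 1))
theorem2p19 n 2≤n L A ld I =
  (vertices-nonempty A 2≤n ld I , diameter≤2 A ld I) ,
  (λ oz → mk⇔ (diameter-one⇒Mₙ L A 2≤n oz I) (Mₙ⇒diameter-one L 2≤n)) ,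
  girth-three⇔ , girth-four⇔ , girth-infinite⇔
  where
  open LowerDismantlable L
  open Girth L A 2≤n ld I
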